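{- Let $\mathbb{C}_1$ and $\mathbb{C}_2$ be process calculi such that $\mathbb{C}_1$ is not strongly replacement free and $\mathbb{C}_2$ is strongly replacement free. Then there is no basic encoding of $\mathbb{C}_1$ into $\mathbb{C}_2$.
   Context: A process calculus consists of processes built from operators, contexts, and a labelled transition semantics whose labels are actions, each either visible or the invisible action $\tau$. A $k$-hole context is a term in which $k$ sub-terms are replaced by holes $[\cdot]_1,\dots,[\cdot]_k$; $C[P_1,\dots,P_k]$ denotes the filling of the holes. $\Rightarrow$ is the reflexive-transitive closure of $\xrightarrow{\tau}$. $P\Downarrow$ ($P$ is visible) iff there exist a visible action $\alpha$ and $P'$ with $P\Rightarrow\xrightarrow{\alpha}\Rightarrow P'$; $P$ is invisible iff not $P\Downarrow$. A calculus is strongly replacement free if for every (1-hole) context $C$, every invisible process $I$ and every process $P$ of the calculus, $C[I]\Downarrow$ implies $C[P]\Downarrow$. An encoding $[\![\cdot]\!]$ (a function from processes of $\mathbb{C}_1$ to processes of $\mathbb{C}_2$) is basic if (i) it is compositional: for every $k$-ary operator $op$ of $\mathbb{C}_1$ there is a $k$-hole context $C_{op}$ of $\mathbb{C}_2$ with $[\![op(P_1,\dots,P_k)]\!]=C_{op}[[\![P_1]\!],\dots,[\![P_k]\!]]$ for all $P_1,\dots,P_k$; and (ii) it is interaction sensitive: for every process $P$ of $\mathbb{C}_1$, $P\Downarrow$ iff $[\![P]\!]\Downarrow$. -}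

module Defs where

open import Data.Nat using (ℕ)
open import Data.Fin using (Fin)
open import Data.Vec using (Vec; []; _∷_; lookup)
open import Data.Product using (∃; ∃-syntax; _×_; Σ-syntax)
open import Relation.Nullary using (¬_)
open import Relation.Binary.PropositionalEquality using (_≡_)
open import Relation.Binary.Construct.Closure.ReflexiveTransitive using (Star)
open import Function.Bundles using (_⇔_)

-- A signature of process operators: each operator has a (finite) arity.
-- Families of operators (prefixes a.(-), restrictions (νx)(-), …) are
-- represented by an index set Op that may be infinite.
record Signature : Set₁ where
  field
    Op    : Set
    arity : Op → ℕ

module _ (Σ : Signature) where
  open Signature Σ

  data Proc : Set where
    op : (o : Op) → Vec Proc (arity o) → Proc

  data Ctx (k : ℕ) : Set where
    hole : Fin k → Ctx k
    op   : (o : Op) → Vec (Ctx k) (arity o) → Ctx k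

  mutual
    fill : ∀ {k} → Ctx k → Vec Proc k → Proc
    fill (hole i) Ps = lookup Ps i
    fill (op o Cs) Ps = op o (fillAll Cs Ps)

    fillAll : ∀ {k n} → Vec (Ctx k) n → Vec Proc k → Vec Proc n
    fillAll [] Ps = []
    fillAll (C ∷ Cs) Ps = fill C Ps ∷ fillAll Cs Ps

record Calculus : Set₁ where
  field
    sig   : Signature
    Act   : Set
    τ     : Act
    _—[_]→_ : Proc sig → Act → Proc sig → Set

  P : Set
  P = Proc sig

  Visible : Act → Set
  Visible α = ¬ (α ≡ τ)

  _—τ→_ : P → P → Set
  p —τ→ q = p —[ τ ]→ q

  _⇒_ : P → P → Set
  _⇒_ = Star _—τ→_

  _⇓ : P → Set
  p ⇓ = ∃[ α ] ∃[ p₁ ] ∃[ p₂ ] ∃[ p' ]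
          (Visible α × p ⇒ p₁ × p₁ —[ α ]→ p₂ × p₂ ⇒ p')

  Invisible : P → Set
  Invisible p = ¬ (p ⇓)

StronglyReplacementFree : Calculus → Set
StronglyReplacementFree 𝒞 =
  (C : Ctx sig 1) (I p : P) → Invisible I →
  fill sig C (I ∷ []) ⇓ → fill sig C (p ∷ []) ⇓
  where open Calculus 𝒞

record BasicEncoding (𝒞₁ 𝒞₂ : Calculus) : Set where
  private
    module C₁ = Calculus 𝒞₁
    module C₂ = Calculus 𝒞₂
    open Signature
  field
    ⟦_⟧  : C₁.P → C₂.P
    Cop  : (o : Op C₁.sig) → Ctx C₂.sig (arity C₁.sig o)
    compositional : (o : Op C₁.sig) (Ps : Vec C₁.P (arity C₁.sig o)) →
      ⟦ op o Ps ⟧ ≡ fill C₂.sig (Cop o) (Data.Vec.map ⟦_⟧ Ps)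
    interaction-sensitive : (p : C₁.P) → C₁._⇓ p ⇔ C₂._⇓ ⟦ p ⟧

-- A compositional encoding maps every context C of 𝒞₁ to a context ⟦C⟧ of 𝒞₂
-- with ⟦C[P⃗]⟧ = ⟦C⟧[⟦P⃗⟧] (substitute the operator contexts C_op for the
-- operators of C). Interaction sensitivity then transports strong replacement
-- freedom of 𝒞₂ back along ⟦_⟧: if C[I]⇓ with I invisible, then ⟦C⟧[⟦I⟧]⇓
-- with ⟦I⟧ invisible, hence ⟦C⟧[⟦P⟧]⇓, hence C[P]⇓. So 𝒞₁ would be strongly
-- replacement free as well.
module Submission where

open import Defs
open import Relation.Nullary using (¬_)
open import Data.Fin using (Fin; zero; suc)
open import Data.Vec using (Vec; []; _∷_; lookup; map)
open import Data.Vec.Properties using (lookup-map)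
open import Relation.Binary.PropositionalEquality
  using (_≡_; refl; cong; cong₂; sym; subst; module ≡-Reasoning)
open import Function.Bundles using (Equivalence)

module ContextSubstitution (S : Signature) where
  open Signature S

  mutual
    _⟪_⟫ : ∀ {n k} → Ctx S n → Vec (Ctx S k) n → Ctx S k
    hole i  ⟪ Ds ⟫ = lookup Ds i
    op o Cs ⟪ Ds ⟫ = op o (Cs ⟪ Ds ⟫*)

    _⟪_⟫* : ∀ {n k m} → Vec (Ctx S n) m → Vec (Ctx S k) n → Vec (Ctx S k) m
    []       ⟪ Ds ⟫* = []
    (C ∷ Cs) ⟪ Ds ⟫* = C ⟪ Ds ⟫ ∷ Cs ⟪ Ds ⟫*

  lookup-fillAll : ∀ {k n} (Ds : Vec (Ctx S k) n) (Ps : Vec (Proc S) k) (i : Fin n) →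
    fill S (lookup Ds i) Ps ≡ lookup (fillAll S Ds Ps) i
  lookup-fillAll (D ∷ Ds) Ps zero    = refl
  lookup-fillAll (D ∷ Ds) Ps (suc i) = lookup-fillAll Ds Ps i

  mutual
    fill-⟪⟫ : ∀ {n k} (C : Ctx S n) (Ds : Vec (Ctx S k) n) (Ps : Vec (Proc S) k) →
      fill S (C ⟪ Ds ⟫) Ps ≡ fill S C (fillAll S Ds Ps)
    fill-⟪⟫ (hole i)  Ds Ps = lookup-fillAll Ds Ps i
    fill-⟪⟫ (op o Cs) Ds Ps = cong (op o) (fillAll-⟪⟫* Cs Ds Ps)

    fillAll-⟪⟫* : ∀ {n k m} (Cs : Vec (Ctx S n) m) (Ds : Vec (Ctx S k) n) (Ps : Vec (Proc S) k) →
      fillAll S (Cs ⟪ Ds ⟫*) Ps ≡ fillAll S Cs (fillAll S Ds Ps)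
    fillAll-⟪⟫* []       Ds Ps = refl
    fillAll-⟪⟫* (C ∷ Cs) Ds Ps = cong₂ _∷_ (fill-⟪⟫ C Ds Ps) (fillAll-⟪⟫* Cs Ds Ps)

module EncodingOfContexts {𝒞₁ 𝒞₂ : Calculus} (E : BasicEncoding 𝒞₁ 𝒞₂) where
  private
    module C₁ = Calculus 𝒞₁
    module C₂ = Calculus 𝒞₂
  open BasicEncoding E
  open ContextSubstitution C₂.sig

  mutual
    ⟦_⟧ᶜ : ∀ {k} → Ctx C₁.sig k → Ctx C₂.sig k
    ⟦ hole i  ⟧ᶜ = hole i
    ⟦ op o Cs ⟧ᶜ = Cop o ⟪ ⟦ Cs ⟧ᶜ* ⟫

    ⟦_⟧ᶜ* : ∀ {k m} → Vec (Ctx C₁.sig k) m → Vec (Ctx C₂.sig k) m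
    ⟦ []     ⟧ᶜ* = []
    ⟦ C ∷ Cs ⟧ᶜ* = ⟦ C ⟧ᶜ ∷ ⟦ Cs ⟧ᶜ*

  mutual
    ⟦fill⟧ : ∀ {k} (C : Ctx C₁.sig k) (Ps : Vec C₁.P k) →
      ⟦ fill C₁.sig C Ps ⟧ ≡ fill C₂.sig ⟦ C ⟧ᶜ (map ⟦_⟧ Ps)
    ⟦fill⟧ (hole i)  Ps = sym (lookup-map i ⟦_⟧ Ps)
    ⟦fill⟧ (op o Cs) Ps = begin
      ⟦ op o (fillAll C₁.sig Cs Ps) ⟧
        ≡⟨ compositional o (fillAll C₁.sig Cs Ps) ⟩
      fill C₂.sig (Cop o) (map ⟦_⟧ (fillAll C₁.sig Cs Ps))
        ≡⟨ cong (fill C₂.sig (Cop o)) (⟦fillAll⟧ Cs Ps) ⟩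
      fill C₂.sig (Cop o) (fillAll C₂.sig ⟦ Cs ⟧ᶜ* (map ⟦_⟧ Ps))
        ≡⟨ sym (fill-⟪⟫ (Cop o) ⟦ Cs ⟧ᶜ* (map ⟦_⟧ Ps)) ⟩
      fill C₂.sig (Cop o ⟪ ⟦ Cs ⟧ᶜ* ⟫) (map ⟦_⟧ Ps)
        ∎
      where open ≡-Reasoning

    ⟦fillAll⟧ : ∀ {k m} (Cs : Vec (Ctx C₁.sig k) m) (Ps : Vec C₁.P k) →
      map ⟦_⟧ (fillAll C₁.sig Cs Ps) ≡ fillAll C₂.sig ⟦ Cs ⟧ᶜ* (map ⟦_⟧ Ps)
    ⟦fillAll⟧ []       Ps = refl
    ⟦fillAll⟧ (C ∷ Cs) Ps = cong₂ _∷_ (⟦fill⟧ C Ps) (⟦fillAll⟧ Cs Ps)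

basicEncoding-reflects-StronglyReplacementFree : {𝒞₁ 𝒞₂ : Calculus} →
  BasicEncoding 𝒞₁ 𝒞₂ → StronglyReplacementFree 𝒞₂ → StronglyReplacementFree 𝒞₁
basicEncoding-reflects-StronglyReplacementFree {𝒞₁} {𝒞₂} E srf₂ C I p invisible-I C[I]⇓ =
  reflect⇓ (fill C₁.sig C (p ∷ []))
    (subst C₂._⇓ (sym (⟦fill⟧ C (p ∷ [])))
      (srf₂ ⟦ C ⟧ᶜ ⟦ I ⟧ ⟦ p ⟧
        (λ ⟦I⟧⇓ → invisible-I (reflect⇓ I ⟦I⟧⇓))
        (subst C₂._⇓ (⟦fill⟧ C (I ∷ [])) (preserve⇓ (fill C₁.sig C (I ∷ [])) C[I]⇓))))
  where
    module C₁ = Calculus 𝒞₁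
    module C₂ = Calculus 𝒞₂
    open BasicEncoding E
    open EncodingOfContexts E

    preserve⇓ : (q : C₁.P) → C₁._⇓ q → C₂._⇓ ⟦ q ⟧
    preserve⇓ q = Equivalence.to (interaction-sensitive q)

    reflect⇓ : (q : C₁.P) → C₂._⇓ ⟦ q ⟧ → C₁._⇓ q
    reflect⇓ q = Equivalence.from (interaction-sensitive q)

theorem2p8 : (𝒞₁ 𝒞₂ : Calculus) → ¬ StronglyReplacementFree 𝒞₁ → StronglyReplacementFree 𝒞₂ → ¬ BasicEncoding 𝒞₁ 𝒞₂
theorem2p8 𝒞₁ 𝒞₂ ¬srf₁ srf₂ E = ¬srf₁ (basicEncoding-reflects-StronglyReplacementFree E srf₂)
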